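{- Let $M=(y_{ij})$ be an $m\times r$ integer matrix with columns $y_1,\dots,y_r\in\mathbb{Z}^m$, and let $X$ be the standardized abelian Cayley graph with Heuberger matrix $M$. For each $j$ let $s_j=y_{1j}+\cdots+y_{mj}$ be the $j$th column sum. Then $\chi(X)=2$ if and only if $s_j$ is even for every $j=1,\dots,r$.
   Context: Given an $m\times r$ integer matrix $M$, let $H$ be the subgroup of $\mathbb{Z}^m$ generated by the columns of $M$, let $e_1,\dots,e_m$ be the standard basis of $\mathbb{Z}^m$, and $S=\{H\pm e_1,\dots,H\pm e_m\}$. The standardized abelian Cayley graph with Heuberger matrix $M$ is $\mathrm{Cay}(\mathbb{Z}^m/H,S)$ (vertices $\mathbb{Z}^m/H$, $x\sim y$ iff $x-y\in S$; loops allowed, no multiple edges). $\chi$ denotes chromatic number; a graph with a loop has no proper coloring. -}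

module Defs where

open import Data.Nat using (ℕ; zero; suc; _<_)
open import Data.Fin using (Fin; zero; suc)
open import Data.Integer using (ℤ; _+_; _-_; _*_; 0ℤ; 1ℤ)
open import Data.Product using (Σ; ∃; _×_)
open import Data.Sum using (_⊎_)
open import Relation.Binary.PropositionalEquality using (_≡_; _≢_)
open import Relation.Nullary using (¬_)

Vecℤ : ℕ → Set
Vecℤ m = Fin m → ℤ

Matrix : ℕ → ℕ → Set
Matrix m r = Fin m → Fin r → ℤ

sumℤ : ∀ {n} → (Fin n → ℤ) → ℤ
sumℤ {zero}  f = 0ℤ
sumℤ {suc n} f = f zero + sumℤ (λ i → f (suc i))

e : ∀ {m} → Fin m → Vecℤ m
e i k with i Data.Fin.≟ k
... | Relation.Nullary.yes _ = 1ℤ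
... | Relation.Nullary.no  _ = 0ℤ

_⊕_ _⊖_ : ∀ {m} → Vecℤ m → Vecℤ m → Vecℤ m
(x ⊕ y) k = x k + y k
(x ⊖ y) k = x k - y k

InH : ∀ {m r} → Matrix m r → Vecℤ m → Set
InH {m} {r} M v = Σ (Fin r → ℤ) λ a → ∀ i → v i ≡ sumℤ (λ j → a j * M i j)

-- Adjacency in Cay(ℤ^m/H, S), S = {H ± e_i}, lifted to representatives:
-- x + H ∼ y + H  iff  x - y ∈ H + e_i or x - y ∈ H - e_i for some i.
Adj : ∀ {m r} → Matrix m r → Vecℤ m → Vecℤ m → Set
Adj {m} M x y = Σ (Fin m) λ i → InH M ((x ⊖ y) ⊖ e i) ⊎ InH M ((x ⊖ y) ⊕ e i)

-- A proper k-colouring of Cay(ℤ^m/H, S): a map on ℤ^m constant on cosets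
-- of H (i.e. a map on ℤ^m/H) giving adjacent vertices distinct colours.
-- (A loop x ∼ x makes this impossible, as required.)
Colorable : ∀ {m r} → Matrix m r → ℕ → Set
Colorable {m} M k = Σ (Vecℤ m → Fin k) λ c →
  (∀ x y → InH M (x ⊖ y) → c x ≡ c y) ×
  (∀ x y → Adj M x y → c x ≢ c y)

ChromaticNumberIs : ∀ {m r} → Matrix m r → ℕ → Set
ChromaticNumberIs M k = Colorable M k × (∀ j → j < k → ¬ Colorable M j)

colSum : ∀ {m r} → Matrix m r → Fin r → ℤ
colSum M j = sumℤ (λ i → M i j)

-- The coordinate sum σ : ℤ^m → ℤ sends every generator ±e_i to ±1, so σ changes
-- parity along every edge. If all column sums are even then σ(H) consists of even
-- numbers, and colouring a coset x + H by the parity of σ(x) is a proper 2-colouring.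
-- Conversely, in a 2-colouring every step x ↦ x ± e_i switches the colour, so x has
-- the colour of 0 exactly when σ(x) is even; each column lies in H and therefore has
-- the colour of 0, so its sum is even. One generator already forces two colours.
module Submission where

open import Defs
open import Data.Nat using (ℕ; suc)
open import Data.Fin using (Fin)
open import Data.Integer using (ℤ; +_)
open import Data.Integer.Divisibility using (_∣_)
open import Function.Bundles using (_⇔_)

open import Data.Nat using (zero; _≤_; z≤n; s≤s)
open import Data.Nat.Properties using (<⇒≱)
open import Data.Nat.Divisibility using (∣1⇒≡1)
open import Data.Fin using (zero; suc)
open import Data.Integer using (-[1+_]; 0ℤ; 1ℤ; -1ℤ; _-_; _*_; _+_; _%ℕ_; _/ℕ_)
import Data.Integer.Properties as ℤ
open import Data.Integer.DivMod using (n%ℕd<d; a≡a%ℕn+[a/ℕn]*n)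
open import Data.Integer.Divisibility.Signed as Signed
  using (divides; _∣?_; ∣m∣n⇒∣m+n; ∣m∣n⇒∣m-n; ∣m+n∣m⇒∣n; ∣m+n∣n⇒∣m; ∣n⇒∣m*n; ∣-refl; ∣⇒∣ᵤ; ∣ᵤ⇒∣)
open import Data.Integer.Solver using (module +-*-Solver)
open +-*-Solver using (solve; con; _:+_; _:-_; _:*_; _:=_)
open import Data.Vec.Functional using (_∷_)
open import Data.Product using (Σ; _,_)
open import Data.Sum using (_⊎_; inj₁; inj₂; [_,_]′)
open import Data.Empty using (⊥-elim)
open import Function using (_∘_; id)
open import Function.Bundles using (mk⇔; Equivalence)
open import Function.Properties.Equivalence using () renaming (trans to ⇔-trans)
open import Relation.Nullary using (¬_; yes; no; Dec)
open import Relation.Binary.PropositionalEquality using (_≡_; _≢_; refl; sym; trans; cong; cong₂; subst; subst₂; module ≡-Reasoning)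

open Equivalence using (to; from)

sumℤ-cong : ∀ {n} {f g : Fin n → ℤ} → (∀ i → f i ≡ g i) → sumℤ f ≡ sumℤ g
sumℤ-cong {zero}  f≗g = refl
sumℤ-cong {suc n} f≗g = cong₂ _+_ (f≗g zero) (sumℤ-cong (f≗g ∘ suc))

sumℤ-zero : ∀ n → sumℤ {n} (λ _ → 0ℤ) ≡ 0ℤ
sumℤ-zero zero    = refl
sumℤ-zero (suc n) = cong (λ s → 0ℤ + s) (sumℤ-zero n)

sumℤ-distrib-+ : ∀ {n} (f g : Fin n → ℤ) → sumℤ (λ i → f i + g i) ≡ sumℤ f + sumℤ g
sumℤ-distrib-+ {zero}  f g = refl
sumℤ-distrib-+ {suc n} f g =
  trans (cong (λ s → f zero + g zero + s) (sumℤ-distrib-+ (f ∘ suc) (g ∘ suc)))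
        (solve 4 (λ a b c d → (a :+ b) :+ (c :+ d) := (a :+ c) :+ (b :+ d)) refl
               (f zero) (g zero) (sumℤ (f ∘ suc)) (sumℤ (g ∘ suc)))

sumℤ-distrib-- : ∀ {n} (f g : Fin n → ℤ) → sumℤ (λ i → f i - g i) ≡ sumℤ f - sumℤ g
sumℤ-distrib-- {zero}  f g = refl
sumℤ-distrib-- {suc n} f g =
  trans (cong (λ s → f zero - g zero + s) (sumℤ-distrib-- (f ∘ suc) (g ∘ suc)))
        (solve 4 (λ a b c d → (a :- b) :+ (c :- d) := (a :+ c) :- (b :+ d)) refl
               (f zero) (g zero) (sumℤ (f ∘ suc)) (sumℤ (g ∘ suc)))

*-distribˡ-sumℤ : ∀ {n} (a : ℤ) (f : Fin n → ℤ) → sumℤ (λ i → a * f i) ≡ a * sumℤ f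
*-distribˡ-sumℤ {zero}  a f = sym (ℤ.*-zeroʳ a)
*-distribˡ-sumℤ {suc n} a f =
  trans (cong (λ s → a * f zero + s) (*-distribˡ-sumℤ a (f ∘ suc)))
        (sym (ℤ.*-distribˡ-+ a (f zero) (sumℤ (f ∘ suc))))

sumℤ-comm : ∀ {n k} (f : Fin n → Fin k → ℤ) →
            sumℤ (λ i → sumℤ (f i)) ≡ sumℤ (λ j → sumℤ (λ i → f i j))
sumℤ-comm {zero}  {k} f = sym (sumℤ-zero k)
sumℤ-comm {suc n} {k} f =
  trans (cong (λ s → sumℤ (f zero) + s) (sumℤ-comm (f ∘ suc)))
        (sym (sumℤ-distrib-+ (f zero) (λ j → sumℤ (λ i → f (suc i) j))))

e-suc : ∀ {n} (i k : Fin n) → e (suc i) (suc k) ≡ e i k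
e-suc i k with i Data.Fin.≟ k
... | yes _ = refl
... | no  _ = refl

sumℤ-e-* : ∀ {n} (j : Fin n) (f : Fin n → ℤ) → sumℤ (λ k → e j k * f k) ≡ f j
sumℤ-e-* {suc n} zero f = begin
  1ℤ * f zero + sumℤ (λ k → 0ℤ * f (suc k)) ≡⟨ cong (λ s → 1ℤ * f zero + s) (sumℤ-cong (ℤ.*-zeroˡ ∘ f ∘ suc)) ⟩
  1ℤ * f zero + sumℤ {n} (λ _ → 0ℤ)         ≡⟨ cong (λ s → 1ℤ * f zero + s) (sumℤ-zero n) ⟩
  1ℤ * f zero + 0ℤ                          ≡⟨ ℤ.+-identityʳ _ ⟩
  1ℤ * f zero                               ≡⟨ ℤ.*-identityˡ (f zero) ⟩
  f zero                                    ∎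
  where open ≡-Reasoning
sumℤ-e-* {suc n} (suc j) f = begin
  0ℤ * f zero + sumℤ (λ k → e (suc j) (suc k) * f (suc k))
    ≡⟨ cong (λ s → 0ℤ * f zero + s) (sumℤ-cong (λ k → cong (_* f (suc k)) (e-suc j k))) ⟩
  0ℤ + sumℤ (λ k → e j k * f (suc k))
    ≡⟨ ℤ.+-identityˡ _ ⟩
  sumℤ (λ k → e j k * f (suc k))
    ≡⟨ sumℤ-e-* j (f ∘ suc) ⟩
  f (suc j) ∎
  where open ≡-Reasoning

sumℤ-e : ∀ {n} (i : Fin n) → sumℤ (e i) ≡ 1ℤ
sumℤ-e i = trans (sumℤ-cong (sym ∘ ℤ.*-identityʳ ∘ e i)) (sumℤ-e-* i (λ _ → 1ℤ))

sumℤ-⊕e : ∀ {m} (x : Vecℤ m) i → sumℤ (x ⊕ e i) ≡ sumℤ x + 1ℤ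
sumℤ-⊕e x i = trans (sumℤ-distrib-+ x (e i)) (cong (λ s → sumℤ x + s) (sumℤ-e i))

sumℤ-⊖e : ∀ {m} (x : Vecℤ m) i → sumℤ (x ⊖ e i) ≡ sumℤ x - 1ℤ
sumℤ-⊖e x i = trans (sumℤ-distrib-- x (e i)) (cong (λ s → sumℤ x - s) (sumℤ-e i))

ℤ-ind : (Q : ℤ → Set) → Q 0ℤ → (∀ t → Q t → Q (1ℤ + t)) → (∀ t → Q t → Q (-1ℤ + t)) →
        ∀ t → Q t
ℤ-ind Q q₀ up down (+ zero)      = q₀
ℤ-ind Q q₀ up down (+ suc n)     = up (+ n) (ℤ-ind Q q₀ up down (+ n))
ℤ-ind Q q₀ up down -[1+ zero ]   = down 0ℤ q₀
ℤ-ind Q q₀ up down -[1+ suc n ]  = down -[1+ n ] (ℤ-ind Q q₀ up down -[1+ n ])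

0ᵥ : ∀ {m} → Vecℤ m
0ᵥ _ = 0ℤ

infix 4 _≈_
_≈_ : ∀ {m} → Vecℤ m → Vecℤ m → Set
x ≈ y = ∀ i → x i ≡ y i

-- Vectors are functions and there is no function extensionality, hence the
-- invariance of P under pointwise equality.
Vecℤ-ind : ∀ {m} (P : Vecℤ m → Set) → (∀ {x y} → x ≈ y → P x → P y) → P 0ᵥ →
           (∀ x i → P x → P (x ⊕ e i)) → (∀ x i → P x → P (x ⊖ e i)) → ∀ x → P x
Vecℤ-ind {zero}  P resp p₀ up down x = resp (λ ()) p₀
Vecℤ-ind {suc m} P resp p₀ up down x =
  resp (λ { zero → refl ; (suc k) → refl }) (Vecℤ-ind P′ resp′ p₀′ up′ down′ (x ∘ suc) (x zero))
  where
  P′ : Vecℤ m → Set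
  P′ y = ∀ t → P (t ∷ y)

  resp′ : ∀ {y y′} → y ≈ y′ → P′ y → P′ y′
  resp′ y≈y′ p t = resp (λ { zero → refl ; (suc k) → y≈y′ k }) (p t)

  p₀′ : P′ 0ᵥ
  p₀′ = ℤ-ind (λ t → P (t ∷ 0ᵥ))
    (resp (λ { zero → refl ; (suc k) → refl }) p₀)
    (λ t p → resp (λ { zero → ℤ.+-comm t 1ℤ ; (suc k) → refl }) (up _ zero p))
    (λ t p → resp (λ { zero → ℤ.+-comm t -1ℤ ; (suc k) → refl }) (down _ zero p))

  up′ : ∀ y i → P′ y → P′ (y ⊕ e i)
  up′ y i p t = resp (λ { zero → ℤ.+-identityʳ t ; (suc k) → cong (λ s → y k + s) (e-suc i k) })
                     (up _ (suc i) (p t))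

  down′ : ∀ y i → P′ y → P′ (y ⊖ e i)
  down′ y i p t = resp (λ { zero → ℤ.+-identityʳ t ; (suc k) → cong (λ s → y k - s) (e-suc i k) })
                       (down _ (suc i) (p t))

Even : ℤ → Set
Even z = + 2 Signed.∣ z

even? : ∀ z → Dec (Even z)
even? z = + 2 ∣? z

even-0 : Even 0ℤ
even-0 = divides 0ℤ refl

¬even-1 : ¬ Even 1ℤ
¬even-1 2∣1 with ∣1⇒≡1 (∣⇒∣ᵤ 2∣1)
... | ()

even-or-odd : ∀ z → Even z ⊎ Even (z + 1ℤ)
even-or-odd z with z %ℕ 2 | n%ℕd<d z 2 | a≡a%ℕn+[a/ℕn]*n z 2
... | 0           | _             | z≡ = inj₁ (divides (z /ℕ 2) (trans z≡ (ℤ.+-identityˡ _)))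
... | 1           | _             | z≡ = inj₂ (divides (z /ℕ 2 + 1ℤ) (trans (cong (_+ 1ℤ) z≡)
  (solve 1 (λ q → con 1ℤ :+ q :* con (+ 2) :+ con 1ℤ := (q :+ con 1ℤ) :* con (+ 2)) refl (z /ℕ 2))))
... | suc (suc _) | s≤s (s≤s ()) | _

even-sumℤ : ∀ {n} {f : Fin n → ℤ} → (∀ i → Even (f i)) → Even (sumℤ f)
even-sumℤ {zero}  _  = even-0
even-sumℤ {suc n} ev = ∣m∣n⇒∣m+n (ev zero) (even-sumℤ (ev ∘ suc))

even-suc⇔¬even : ∀ z → Even (z + 1ℤ) ⇔ (¬ Even z)
even-suc⇔¬even z = mk⇔
  (λ 2∣z+1 2∣z → ¬even-1 (∣m+n∣m⇒∣n 2∣z+1 2∣z))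
  (λ ¬2∣z → [ ⊥-elim ∘ ¬2∣z , id ]′ (even-or-odd z))

even-+-even : ∀ {a} b → Even a → Even b ⇔ Even (b + a)
even-+-even b 2∣a = mk⇔ (λ 2∣b → ∣m∣n⇒∣m+n 2∣b 2∣a) (λ 2∣b+a → ∣m+n∣n⇒∣m 2∣b+a 2∣a)

even-pred⇔¬even : ∀ z → Even (z - 1ℤ) ⇔ (¬ Even z)
even-pred⇔¬even z = ⇔-trans (⇔-trans (even-+-even (z - 1ℤ) (∣-refl {+ 2})) pred+2≡suc)
                            (even-suc⇔¬even z)
  where
  pred+2≡suc : Even (z - 1ℤ + + 2) ⇔ Even (z + 1ℤ)
  pred+2≡suc = mk⇔ (subst Even eq) (subst Even (sym eq))
    where eq = solve 1 (λ t → t :- con 1ℤ :+ con (+ 2) := t :+ con 1ℤ) refl z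

parity : ℤ → Fin 2
parity z with even? z
... | yes _ = zero
... | no  _ = suc zero

parity-≡⇔even-diff : ∀ a b → parity a ≡ parity b ⇔ Even (a - b)
parity-≡⇔even-diff a b with even? a | even? b
... | yes 2∣a | yes 2∣b = mk⇔ (λ _ → ∣m∣n⇒∣m-n 2∣a 2∣b) (λ _ → refl)
... | yes 2∣a | no ¬2∣b = mk⇔ (λ ()) (λ 2∣a-b → ⊥-elim (¬2∣b (subst Even
  (solve 2 (λ a b → a :- (a :- b) := b) refl a b) (∣m∣n⇒∣m-n 2∣a 2∣a-b))))
... | no ¬2∣a | yes 2∣b = mk⇔ (λ ()) (λ 2∣a-b → ⊥-elim (¬2∣a (subst Even
  (solve 2 (λ a b → (a :- b) :+ b := a) refl a b) (∣m∣n⇒∣m+n 2∣a-b 2∣b))))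
... | no ¬2∣a | no ¬2∣b = mk⇔ (λ _ → subst Even
  (solve 2 (λ a b → (a :+ con 1ℤ) :- (b :+ con 1ℤ) := a :- b) refl a b)
  (∣m∣n⇒∣m-n (from (even-suc⇔¬even a) ¬2∣a) (from (even-suc⇔¬even b) ¬2∣b))) (λ _ → refl)

fin2-≢⇒≡⇔≢ : {a b d : Fin 2} → a ≢ b → a ≡ d ⇔ b ≢ d
fin2-≢⇒≡⇔≢ a≢b = mk⇔ (λ { refl b≡a → a≢b (sym b≡a) }) (third a≢b)
  where
  third : {a b d : Fin 2} → a ≢ b → b ≢ d → a ≡ d
  third {zero}     {zero}               a≢b _   = ⊥-elim (a≢b refl)
  third {suc zero} {suc zero}           a≢b _   = ⊥-elim (a≢b refl)
  third {_}        {zero}     {zero}     _   b≢d = ⊥-elim (b≢d refl)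
  third {_}        {suc zero} {suc zero} _   b≢d = ⊥-elim (b≢d refl)
  third {zero}     {suc zero} {zero}     _   _   = refl
  third {suc zero} {zero}     {suc zero} _   _   = refl

2≤-of-distinct : ∀ {k} {a b : Fin k} → a ≢ b → 2 ≤ k
2≤-of-distinct {suc zero}    {zero} {zero} a≢b = ⊥-elim (a≢b refl)
2≤-of-distinct {suc (suc k)}                _   = s≤s (s≤s z≤n)

⇔-negated : {A A′ B B′ : Set} → A ⇔ B → A′ ⇔ (¬ A) → B′ ⇔ (¬ B) → A′ ⇔ B′
⇔-negated A⇔B A′⇔¬A B′⇔¬B = mk⇔
  (λ a′ → from B′⇔¬B (λ b → to A′⇔¬A a′ (from A⇔B b)))
  (λ b′ → from A′⇔¬A (λ a → to B′⇔¬B b′ (to A⇔B a)))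

module _ {m : ℕ} (c : Vecℤ m → Fin 2) (c-cong : ∀ {x y} → x ≈ y → c x ≡ c y)
         (c-flip : ∀ x i → c (x ⊕ e i) ≢ c x) where

  two-colouring-parity : ∀ x → c x ≡ c 0ᵥ ⇔ Even (sumℤ x)
  two-colouring-parity = Vecℤ-ind P resp base up down
    where
    P : Vecℤ m → Set
    P x = c x ≡ c 0ᵥ ⇔ Even (sumℤ x)

    resp : ∀ {x y} → x ≈ y → P x → P y
    resp x≈y = subst₂ (λ u s → u ≡ c 0ᵥ ⇔ Even s) (c-cong x≈y) (sumℤ-cong x≈y)

    base : P 0ᵥ
    base = mk⇔ (λ _ → subst Even (sym (sumℤ-zero m)) even-0) (λ _ → refl)

    up : ∀ x i → P x → P (x ⊕ e i)
    up x i Px = ⇔-negated Px (fin2-≢⇒≡⇔≢ (c-flip x i))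
      (subst (λ s → Even s ⇔ (¬ Even (sumℤ x))) (sym (sumℤ-⊕e x i)) (even-suc⇔¬even (sumℤ x)))

    down : ∀ x i → P x → P (x ⊖ e i)
    down x i Px = ⇔-negated Px (fin2-≢⇒≡⇔≢ (λ eq → c-flip (x ⊖ e i) i (trans (c-cong back) (sym eq))))
      (subst (λ s → Even s ⇔ (¬ Even (sumℤ x))) (sym (sumℤ-⊖e x i)) (even-pred⇔¬even (sumℤ x)))
      where
      back : (x ⊖ e i) ⊕ e i ≈ x
      back k = solve 2 (λ a b → a :- b :+ b := a) refl (x k) (e i k)

module _ {m r : ℕ} (M : Matrix m r) where

  InH-resp : ∀ {u v} → u ≈ v → InH M u → InH M v
  InH-resp u≈v (a , u≡) = a , λ i → trans (sym (u≈v i)) (u≡ i)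

  InH-zero : ∀ {v} → v ≈ 0ᵥ → InH M v
  InH-zero v≈0 = (λ _ → 0ℤ) , λ i →
    trans (v≈0 i) (sym (trans (sumℤ-cong (ℤ.*-zeroˡ ∘ M i)) (sumℤ-zero r)))

  ≈⇒InH-⊖ : ∀ {x y} → x ≈ y → InH M (x ⊖ y)
  ≈⇒InH-⊖ {x} x≈y = InH-zero (λ i → trans (cong (λ s → x i - s) (sym (x≈y i))) (ℤ.+-inverseʳ (x i)))

  InH-column : ∀ j → InH M (λ i → M i j)
  InH-column j = e j , λ i → sym (sumℤ-e-* j (M i))

  sumℤ-InH : ∀ {v} → InH M v → Σ (Fin r → ℤ) λ a → sumℤ v ≡ sumℤ (λ j → a j * colSum M j)
  sumℤ-InH {v} (a , v≡) = a , (begin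
    sumℤ v                                    ≡⟨ sumℤ-cong v≡ ⟩
    sumℤ (λ i → sumℤ (λ j → a j * M i j))     ≡⟨ sumℤ-comm (λ i j → a j * M i j) ⟩
    sumℤ (λ j → sumℤ (λ i → a j * M i j))     ≡⟨ sumℤ-cong (λ j → *-distribˡ-sumℤ (a j) (λ i → M i j)) ⟩
    sumℤ (λ j → a j * colSum M j)             ∎)
    where open ≡-Reasoning

  Adj-⊕e : ∀ x i → Adj M (x ⊕ e i) x
  Adj-⊕e x i = i , inj₁ (InH-zero (λ k → solve 2 (λ a b → a :+ b :- a :- b := con 0ℤ) refl (x k) (e i k)))

  2-colourable⇒even-colSum : Colorable M 2 → ∀ j → Even (colSum M j)
  2-colourable⇒even-colSum (c , c-inv , proper) j =
    to (two-colouring-parity c c-cong c-flip column) (c-inv column 0ᵥ column-0ᵥ∈H)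
    where
    column : Vecℤ m
    column i = M i j
    column-0ᵥ∈H : InH M (column ⊖ 0ᵥ)
    column-0ᵥ∈H = InH-resp (λ i → sym (ℤ.+-identityʳ (M i j))) (InH-column j)
    c-cong : ∀ {x y} → x ≈ y → c x ≡ c y
    c-cong x≈y = c-inv _ _ (≈⇒InH-⊖ x≈y)
    c-flip : ∀ x i → c (x ⊕ e i) ≢ c x
    c-flip x i = proper _ _ (Adj-⊕e x i)

  module _ (even-colSum : ∀ j → Even (colSum M j)) where

    InH⇒even-sum : ∀ {v} → InH M v → Even (sumℤ v)
    InH⇒even-sum v∈H with sumℤ-InH v∈H
    ... | a , v≡ = subst Even (sym v≡) (even-sumℤ (λ j → ∣n⇒∣m*n (a j) (even-colSum j)))

    Adj⇒odd-diff : ∀ {x y} → Adj M x y → ¬ Even (sumℤ x - sumℤ y)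
    Adj⇒odd-diff {x} {y} (i , inj₁ x-y-eᵢ∈H) = to (even-pred⇔¬even _)
      (subst Even (trans (sumℤ-⊖e (x ⊖ y) i) (cong (_- 1ℤ) (sumℤ-distrib-- x y))) (InH⇒even-sum x-y-eᵢ∈H))
    Adj⇒odd-diff {x} {y} (i , inj₂ x-y+eᵢ∈H) = to (even-suc⇔¬even _)
      (subst Even (trans (sumℤ-⊕e (x ⊖ y) i) (cong (_+ 1ℤ) (sumℤ-distrib-- x y))) (InH⇒even-sum x-y+eᵢ∈H))

    parity-colouring : Colorable M 2
    parity-colouring = parity ∘ sumℤ
      , (λ x y x-y∈H → from (parity-≡⇔even-diff _ _) (subst Even (sumℤ-distrib-- x y) (InH⇒even-sum x-y∈H)))
      , (λ x y x∼y → Adj⇒odd-diff x∼y ∘ to (parity-≡⇔even-diff _ _))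

colourable⇒2≤ : ∀ {n r k} (M : Matrix (suc n) r) → Colorable M k → 2 ≤ k
colourable⇒2≤ M (c , _ , proper) = 2≤-of-distinct (proper (0ᵥ ⊕ e zero) 0ᵥ (Adj-⊕e M 0ᵥ zero))

lemma2p11 : (n r : ℕ) (M : Matrix (suc n) r) →
    ChromaticNumberIs M 2 ⇔ (∀ (j : Fin r) → + 2 ∣ colSum M j)
lemma2p11 n r M = mk⇔
  (λ (colourable , _) j → ∣⇒∣ᵤ (2-colourable⇒even-colSum M colourable j))
  (λ even → parity-colouring M (∣ᵤ⇒∣ ∘ even)
          , λ k k<2 colourable → <⇒≱ k<2 (colourable⇒2≤ M colourable))
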